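{- Let $t\ge 1$ and $2\le \ell\le 5$ be integers. Then $\chi_p(P_{\ell t}\Diamond_\ell K_5)\le 14$.
   Context: A packing $k$-coloring of a graph $H$ is a map $c:V(H)\to\{1,\ldots,k\}$ such that any two distinct vertices $u,v$ with $c(u)=c(v)=i$ satisfy $d_H(u,v)\ge i+1$. The packing chromatic number $\chi_p(H)$ is the least such $k$. $P_m$ denotes the path $v_1\cdots v_m$ and $K_n$ the complete graph on $n$ vertices. Path-aligned product: for positive integers $\ell\mid m$ and a connected vertex-transitive graph $G$ containing $P_\ell$ as a subgraph, $P_m\Diamond_\ell G$ is formed from the path $P_m=v_1\cdots v_m$ and $m/\ell$ pairwise disjoint copies of $G$, where for each $1\le i\le m/\ell$ the consecutive path vertices $v_{(i-1)\ell+1},\ldots,v_{i\ell}$ are identified, in order, with $\ell$ distinct vertices of the $i$-th copy of $G=K_n$. Consecutive copies are joined only by the path edges $v_{i\ell}v_{i\ell+1}$. -}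

module Defs where

open import Data.Nat using (ℕ; zero; suc; _≤_; _∸_)
open import Data.Fin using (Fin; toℕ)
open import Data.Product using (_×_; _,_; ∃)
open import Data.Sum using (_⊎_)
open import Relation.Binary.PropositionalEquality using (_≡_; _≢_)
open import Relation.Nullary using (¬_)

record Graph : Set₁ where
  field
    V   : Set
    Adj : V → V → Set
open Graph public

-- Walk G d u v : there is a walk of length at most d from u to v,
-- i.e. d_G(u,v) ≤ d.  Hence  d_G(u,v) ≥ i + 1  iff  ¬ Walk G i u v.
data Walk (G : Graph) : ℕ → V G → V G → Set where
  here : ∀ {d u} → Walk G d u u
  step : ∀ {d u w v} → Adj G u w → Walk G d w v → Walk G (suc d) u v

record PackingColoring (G : Graph) (k : ℕ) : Set where
  field
    col     : V G → ℕ
    col-pos : ∀ v → 1 ≤ col v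
    col-≤k  : ∀ v → col v ≤ k
    packing : ∀ u v → u ≢ v → col u ≡ col v → ¬ Walk G (col u) u v

-- χ_p(G) ≤ k : some packing colouring with at most k colours exists
-- (a packing k'-colouring with k' ≤ k is also a packing k-colouring).
χp≤ : Graph → ℕ → Set
χp≤ G k = PackingColoring G k

-- Vertex (i , j) is vertex j of the i-th copy of K_n (i, j 0-based).
-- The path vertex v_{iℓ + r + 1} (0 ≤ i < t, 0 ≤ r < ℓ) is identified with (i , r);
-- path edges inside a copy are already edges of K_n, and consecutive copies are
-- joined only by the path edge v_{(i+1)ℓ} v_{(i+1)ℓ+1}, i.e. (i , ℓ-1) — (i+1 , 0).
PathAlignedK : (n ℓ t : ℕ) → Graph
PathAlignedK n ℓ t = record
  { V   = Fin t × Fin n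
  ; Adj = λ { (i , j) (i' , j') →
              (i ≡ i' × j ≢ j')
            ⊎ (toℕ i' ≡ suc (toℕ i) × toℕ j ≡ ℓ ∸ 1 × toℕ j' ≡ 0)
            ⊎ (toℕ i ≡ suc (toℕ i') × toℕ j' ≡ ℓ ∸ 1 × toℕ j ≡ 0) }
  }

-- The i-th copy of K₅ is coloured by row (i mod 24) of a fixed table whose columns are
-- indexed by the role of a vertex in its copy: entry, exit, or inner.  A walk from copy a
-- to a later copy b crosses every copy in between, entering and leaving each, so the
-- distance from vertex j of copy a to vertex j′ of copy b is at least
-- 2(b − a) − [j is the exit] + [j′ is not the entry].  This is witnessed by a potential
-- that grows by 2 per copy and changes by at most 1 along every edge.  Since colours are
-- at most 14, a colour can only be repeated within 7 consecutive copies, and the finitely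
-- many constraints this puts on the table are decided by evaluation.

module Submission where

open import Data.Bool.Base using (true; false; if_then_else_)
open import Data.Fin using (Fin; toℕ; #_)
open import Data.Fin.Properties using (all?; toℕ-fromℕ<; toℕ-injective; fromℕ<-cong)
  renaming (_≟_ to _≟ᶠ_)
open import Data.Nat.Base
open import Data.Nat.DivMod using (_%_; _mod_; m%n<n; %-distribˡ-+; m%n%n≡m%n)
open import Data.Nat.Properties
open import Data.Nat.Tactic.RingSolver using (solve-∀)
open import Data.Product.Base using (_×_; _,_; proj₁; proj₂)
open import Data.Sum.Base using (inj₁; inj₂)
open import Data.Unit.Base using (tt)
open import Data.Vec.Base using (Vec; []; _∷_; lookup)
open import Function.Base using (_∘_)
open import Relation.Binary.Definitions using (tri<; tri≈; tri>)
open import Relation.Binary.PropositionalEquality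
open import Relation.Nullary using (Dec; yes; no; does; ¬_)
open import Relation.Nullary.Decidable using (dec-true; dec-false; _×-dec_; _→-dec_; toWitness)

open import Defs

Undirected : Graph → Set
Undirected G = ∀ {u v} → Adj G u v → Adj G v u

Lipschitz : (G : Graph) → (V G → ℕ) → Set
Lipschitz G φ = ∀ {u v} → Adj G u v → φ v ≤ suc (φ u)

module _ {G : Graph} where

  walk-snoc : ∀ {d u w v} → Walk G d u w → Adj G w v → Walk G (suc d) u v
  walk-snoc here        e = step e here
  walk-snoc (step e′ p) e = step e′ (walk-snoc p e)

  walk-reverse : Undirected G → ∀ {d u v} → Walk G d u v → Walk G d v u
  walk-reverse sym here       = here
  walk-reverse sym (step e p) = walk-snoc (walk-reverse sym p) (sym e)

  lipschitz-walk : ∀ {φ} → Lipschitz G φ → ∀ {d u v} → Walk G d u v → φ v ≤ d + φ u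
  lipschitz-walk {φ} lip {d} {u} here = m≤n+m (φ u) d
  lipschitz-walk {φ} lip (step {d} {u} {w} {v} e p) = begin
    φ v           ≤⟨ lipschitz-walk lip p ⟩
    d + φ w       ≤⟨ +-monoʳ-≤ d (lip e) ⟩
    d + suc (φ u) ≡⟨ +-suc d (φ u) ⟩
    suc d + φ u   ∎
    where open ≤-Reasoning

PathAlignedK-undirected : ∀ {n ℓ t} → Undirected (PathAlignedK n ℓ t)
PathAlignedK-undirected (inj₁ (refl , j≢j′)) = inj₁ (refl , j≢j′ ∘ sym)
PathAlignedK-undirected (inj₂ (inj₁ edge))    = inj₂ (inj₂ edge)
PathAlignedK-undirected (inj₂ (inj₂ edge))    = inj₂ (inj₁ edge)

exitBit : ℕ → ℕ → ℕ
exitBit ℓ j = if does (j ≟ ℓ ∸ 1) then 1 else 0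

nonEntryBit : ℕ → ℕ
nonEntryBit zero    = 0
nonEntryBit (suc _) = 1

exitBit≤1 : ∀ ℓ j → exitBit ℓ j ≤ 1
exitBit≤1 ℓ j with does (j ≟ ℓ ∸ 1)
... | true  = ≤-refl
... | false = z≤n

nonEntryBit≤1 : ∀ j → nonEntryBit j ≤ 1
nonEntryBit≤1 zero    = z≤n
nonEntryBit≤1 (suc _) = ≤-refl

exitBit-exit : ∀ ℓ → exitBit ℓ (ℓ ∸ 1) ≡ 1
exitBit-exit ℓ rewrite dec-true (ℓ ∸ 1 ≟ ℓ ∸ 1) refl = refl

exitBit-entry : ∀ {ℓ} → 2 ≤ ℓ → exitBit ℓ 0 ≡ 0
exitBit-entry (s≤s (s≤s _)) = refl

nonEntryBit-exit : ∀ {ℓ} → 2 ≤ ℓ → nonEntryBit (ℓ ∸ 1) ≡ 1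
nonEntryBit-exit (s≤s (s≤s _)) = refl

m+b≤1+m : ∀ m {b} → b ≤ 1 → m + b ≤ suc m
m+b≤1+m m b≤1 = ≤-trans (+-monoʳ-≤ m b≤1) (≤-reflexive (+-comm m 1))

-- Before copy k the exit counts as one step ahead, from copy k on every vertex but the
-- entry does; so for a < k ≤ b the potential rises by 2(b − a) − exitBit j + nonEntryBit j′
-- from vertex j of copy a to vertex j′ of copy b.
potential : (ℓ k : ℕ) {n t : ℕ} → Fin t × Fin n → ℕ
potential ℓ k (i , j) =
  2 * toℕ i + (if does (k ≤? toℕ i) then nonEntryBit (toℕ j) else exitBit ℓ (toℕ j))

module _ {n t : ℕ} (ℓ k : ℕ) where

  private
    φ : Fin t × Fin n → ℕ
    φ = potential ℓ k

  potential-before : ∀ {i j} → toℕ i < k → φ (i , j) ≡ 2 * toℕ i + exitBit ℓ (toℕ j)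
  potential-before {i} i<k rewrite dec-false (k ≤? toℕ i) (<⇒≱ i<k) = refl

  potential-from : ∀ {i j} → k ≤ toℕ i → φ (i , j) ≡ 2 * toℕ i + nonEntryBit (toℕ j)
  potential-from {i} k≤i rewrite dec-true (k ≤? toℕ i) k≤i = refl

  potential-upper : ∀ i j → φ (i , j) ≤ suc (2 * toℕ i)
  potential-upper i j with does (k ≤? toℕ i)
  ... | true  = m+b≤1+m (2 * toℕ i) (nonEntryBit≤1 (toℕ j))
  ... | false = m+b≤1+m (2 * toℕ i) (exitBit≤1 ℓ (toℕ j))

  module _ (2≤ℓ : 2 ≤ ℓ) where

    potential-entry : ∀ {i j} → toℕ j ≡ 0 → φ (i , j) ≡ 2 * toℕ i
    potential-entry {i} j≡0 rewrite j≡0 | exitBit-entry 2≤ℓ with does (k ≤? toℕ i)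
    ... | true  = +-identityʳ (2 * toℕ i)
    ... | false = +-identityʳ (2 * toℕ i)

    potential-exit : ∀ {i j} → toℕ j ≡ ℓ ∸ 1 → φ (i , j) ≡ suc (2 * toℕ i)
    potential-exit {i} j≡exit
      rewrite j≡exit | exitBit-exit ℓ | nonEntryBit-exit 2≤ℓ with does (k ≤? toℕ i)
    ... | true  = +-comm (2 * toℕ i) 1
    ... | false = +-comm (2 * toℕ i) 1

    potential-lipschitz : Lipschitz (PathAlignedK n ℓ t) φ
    potential-lipschitz {i , j} {.i , j′} (inj₁ (refl , _)) = begin
      φ (i , j′)      ≤⟨ potential-upper i j′ ⟩
      suc (2 * toℕ i) ≤⟨ s≤s (m≤m+n (2 * toℕ i) _) ⟩
      suc (φ (i , j)) ∎
      where open ≤-Reasoning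
    potential-lipschitz {i , j} {i′ , j′} (inj₂ (inj₁ (i′≡1+i , j≡exit , j′≡0))) =
      ≤-reflexive (begin
        φ (i′ , j′)           ≡⟨ potential-entry j′≡0 ⟩
        2 * toℕ i′            ≡⟨ cong (2 *_) i′≡1+i ⟩
        2 * suc (toℕ i)       ≡⟨ *-suc 2 (toℕ i) ⟩
        suc (suc (2 * toℕ i)) ≡⟨ cong suc (potential-exit j≡exit) ⟨
        suc (φ (i , j))       ∎)
      where open ≡-Reasoning
    potential-lipschitz {i , j} {i′ , j′} (inj₂ (inj₂ (i≡1+i′ , j′≡exit , j≡0))) = begin
      φ (i′ , j′)                   ≡⟨ potential-exit j′≡exit ⟩
      suc (2 * toℕ i′)              ≤⟨ m≤n+m (suc (2 * toℕ i′)) 2 ⟩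
      suc (suc (suc (2 * toℕ i′)))  ≡⟨ cong suc (*-suc 2 (toℕ i′)) ⟨
      suc (2 * suc (toℕ i′))        ≡⟨ cong (λ x → suc (2 * x)) i≡1+i′ ⟨
      suc (2 * toℕ i)               ≡⟨ cong suc (potential-entry j≡0) ⟨
      suc (φ (i , j))               ∎
      where open ≤-Reasoning

copy-distance : ∀ {n ℓ t d s} {a b : Fin t} {j j′ : Fin n} → 2 ≤ ℓ → toℕ b ≡ toℕ a + suc s →
                Walk (PathAlignedK n ℓ t) d (a , j) (b , j′) →
                2 * suc s + nonEntryBit (toℕ j′) ≤ d + exitBit ℓ (toℕ j)
copy-distance {n} {ℓ} {t} {d} {s} {a} {b} {j} {j′} 2≤ℓ b≡a+1+s walk =
  +-cancelˡ-≤ (2 * toℕ a) _ _ (begin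
    2 * toℕ a + (2 * suc s + nonEntryBit (toℕ j′))  ≡⟨ shift (toℕ a) s _ ⟩
    2 * (toℕ a + suc s) + nonEntryBit (toℕ j′)      ≡⟨ cong (λ x → 2 * x + nonEntryBit (toℕ j′)) b≡a+1+s ⟨
    2 * toℕ b + nonEntryBit (toℕ j′)                ≡⟨ potential-from ℓ (toℕ b) ≤-refl ⟨
    φ (b , j′)                                      ≤⟨ lipschitz-walk (potential-lipschitz ℓ (toℕ b) 2≤ℓ) walk ⟩
    d + φ (a , j)                                   ≡⟨ cong (d +_) (potential-before ℓ (toℕ b) a<b) ⟩
    d + (2 * toℕ a + exitBit ℓ (toℕ j))             ≡⟨ swap d (2 * toℕ a) _ ⟩
    2 * toℕ a + (d + exitBit ℓ (toℕ j))             ∎)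
  where
  open ≤-Reasoning
  φ : Fin t × Fin n → ℕ
  φ = potential ℓ (toℕ b)
  a<b : toℕ a < toℕ b
  a<b = subst (toℕ a <_) (sym b≡a+1+s) (m<m+n (toℕ a) z<s)
  shift : ∀ a s x → 2 * a + (2 * suc s + x) ≡ 2 * (a + suc s) + x
  shift = solve-∀
  swap : ∀ x y z → x + (y + z) ≡ y + (x + z)
  swap = solve-∀

m≤2n∧b≤1⇒m+b<2[1+n]+o : ∀ {m b} n o → m ≤ 2 * n → b ≤ 1 → m + b < 2 * suc n + o
m≤2n∧b≤1⇒m+b<2[1+n]+o {m} {b} n o m≤2n b≤1 = begin-strict
  m + b             ≤⟨ m+b≤1+m m b≤1 ⟩
  suc m             ≤⟨ s≤s m≤2n ⟩
  suc (2 * n)       <⟨ n<1+n _ ⟩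
  suc (suc (2 * n)) ≡⟨ *-suc 2 n ⟨
  2 * suc n         ≤⟨ m≤m+n (2 * suc n) o ⟩
  2 * suc n + o     ∎
  where open ≤-Reasoning

Pattern : ℕ → ℕ → Set
Pattern p n = Fin p → Fin n → ℕ

module _ {p : ℕ} .{{_ : NonZero p}} where

  infixl 6 _⊕_
  _⊕_ : Fin p → ℕ → Fin p
  r ⊕ s = (toℕ r + s) mod p

  mod-+ : ∀ m s → (m + s) mod p ≡ m mod p ⊕ s
  mod-+ m s = fromℕ<-cong _ _ (begin
    (m + s) % p             ≡⟨ %-distribˡ-+ m s p ⟩
    (m % p + s % p) % p     ≡⟨ cong (λ x → (x + s % p) % p) (m%n%n≡m%n m p) ⟨
    (m % p % p + s % p) % p ≡⟨ %-distribˡ-+ (m % p) s p ⟨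
    (m % p + s) % p         ≡⟨ cong (λ x → (x + s) % p) (toℕ-fromℕ< (m%n<n m p)) ⟨
    (toℕ (m mod p) + s) % p ∎) (m%n<n _ p) (m%n<n _ p)
    where open ≡-Reasoning

  module _ {n : ℕ} where

    ColoursIn : ℕ → Pattern p n → Set
    ColoursIn k c = ∀ r j → 1 ≤ c r j × c r j ≤ k

    RowInjective : Pattern p n → Set
    RowInjective c = ∀ r j j′ → c r j ≡ c r j′ → j ≡ j′

    -- The distance from vertex j of a copy to vertex j′ of the copy 1 + s further on
    -- is 2 * (1 + s) + nonEntryBit j′ ∸ exitBit j.
    Spread : (ℓ w : ℕ) → Pattern p n → Set
    Spread ℓ w c = ∀ {s} → s < w → ∀ r j j′ → c r j ≡ c (r ⊕ suc s) j′ →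
                   c r j + exitBit ℓ (toℕ j) < 2 * suc s + nonEntryBit (toℕ j′)

    IsPackingPattern : (ℓ k w : ℕ) → Pattern p n → Set
    IsPackingPattern ℓ k w c = ColoursIn k c × RowInjective c × Spread ℓ w c

    isPackingPattern? : ∀ ℓ k w c → Dec (IsPackingPattern ℓ k w c)
    isPackingPattern? ℓ k w c =
      (all? λ r → all? λ j → (1 ≤? c r j) ×-dec (c r j ≤? k))
      ×-dec (all? λ r → all? λ j → all? λ j′ → (c r j ≟ c r j′) →-dec (j ≟ᶠ j′))
      ×-dec allUpTo? (λ s → all? λ r → all? λ j → all? λ j′ →
                       (c r j ≟ c (r ⊕ suc s) j′) →-dec
                       (c r j + exitBit ℓ (toℕ j) <? 2 * suc s + nonEntryBit (toℕ j′))) w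

module _ {p n ℓ k w : ℕ} .{{_ : NonZero p}} (2≤ℓ : 2 ≤ ℓ) (k≤2w : k ≤ 2 * w)
         {c : Pattern p n} (valid : IsPackingPattern ℓ k w c) (t : ℕ) where

  private
    G : Graph
    G = PathAlignedK n ℓ t

    colours-in : ColoursIn k c
    colours-in = proj₁ valid

    row-injective : RowInjective c
    row-injective = proj₁ (proj₂ valid)

    spread : Spread ℓ w c
    spread = proj₂ (proj₂ valid)

    colour : V G → ℕ
    colour (i , j) = c (toℕ i mod p) j

    colour-gap : ∀ {a b : Fin t} {j j′ s} → toℕ b ≡ toℕ a + suc s →
                 colour (a , j) ≡ colour (b , j′) →
                 colour (a , j) + exitBit ℓ (toℕ j) < 2 * suc s + nonEntryBit (toℕ j′)
    colour-gap {a} {b} {j} {j′} {s} b≡a+1+s same with s <? w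
    ... | yes s<w = spread s<w (toℕ a mod p) j j′
          (trans same (cong (λ r → c r j′)
                            (trans (cong (_mod p) b≡a+1+s) (mod-+ (toℕ a) (suc s)))))
    ... | no s≮w  = m≤2n∧b≤1⇒m+b<2[1+n]+o s (nonEntryBit (toℕ j′))
          (≤-trans (proj₂ (colours-in _ j)) (≤-trans k≤2w (*-monoʳ-≤ 2 (≮⇒≥ s≮w))))
          (exitBit≤1 ℓ (toℕ j))

    separated : ∀ {a b : Fin t} {j j′} → toℕ a < toℕ b → colour (a , j) ≡ colour (b , j′) →
                ¬ Walk G (colour (a , j)) (a , j) (b , j′)
    separated {a} {b} a<b same walk =
      <⇒≱ (colour-gap b≡a+1+s same) (copy-distance 2≤ℓ b≡a+1+s walk)
      where
      b≡a+1+s : toℕ b ≡ toℕ a + suc (toℕ b ∸ suc (toℕ a))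
      b≡a+1+s = sym (trans (+-suc (toℕ a) _) (m+[n∸m]≡n a<b))

    packing : ∀ u v → u ≢ v → colour u ≡ colour v → ¬ Walk G (colour u) u v
    packing (i , j) (i′ , j′) u≢v same walk with <-cmp (toℕ i) (toℕ i′)
    ... | tri< i<i′ _ _ = separated i<i′ same walk
    ... | tri> _ _ i′<i = separated i′<i (sym same)
          (subst (λ d → Walk G d (i′ , j′) (i , j)) same
                 (walk-reverse (PathAlignedK-undirected {ℓ = ℓ}) walk))
    ... | tri≈ _ i≡i′ _ with refl ← toℕ-injective i≡i′ =
          u≢v (cong (i ,_) (row-injective (toℕ i mod p) j j′ same))

  periodic-packing : χp≤ G k
  periodic-packing = record
    { col     = colour
    ; col-pos = λ (i , j) → proj₁ (colours-in (toℕ i mod p) j)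
    ; col-≤k  = λ (i , j) → proj₂ (colours-in (toℕ i mod p) j)
    ; packing = packing
    }

-- Row r gives the colours of the copies with index ≡ r (mod 24), listed as
-- entry vertex, exit vertex, then the three inner vertices.
colourTable : Vec (Vec ℕ 5) 24
colourTable =
  (1 ∷  3 ∷ 2 ∷  4 ∷  5 ∷ []) ∷
  (1 ∷  7 ∷ 2 ∷  8 ∷ 11 ∷ []) ∷
  (1 ∷  3 ∷ 2 ∷  4 ∷  6 ∷ []) ∷
  (1 ∷  5 ∷ 2 ∷  9 ∷ 10 ∷ []) ∷
  (1 ∷  3 ∷ 2 ∷  4 ∷ 12 ∷ []) ∷
  (1 ∷  7 ∷ 2 ∷  6 ∷  8 ∷ []) ∷
  (1 ∷  3 ∷ 2 ∷  4 ∷  5 ∷ []) ∷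
  (1 ∷ 11 ∷ 2 ∷ 13 ∷ 14 ∷ []) ∷
  (1 ∷  3 ∷ 2 ∷  4 ∷  6 ∷ []) ∷
  (1 ∷  5 ∷ 2 ∷  7 ∷  8 ∷ []) ∷
  (1 ∷  3 ∷ 2 ∷  4 ∷ 12 ∷ []) ∷
  (1 ∷  9 ∷ 2 ∷  6 ∷ 10 ∷ []) ∷
  (1 ∷  3 ∷ 2 ∷  4 ∷  5 ∷ []) ∷
  (1 ∷  7 ∷ 2 ∷  8 ∷ 11 ∷ []) ∷
  (1 ∷  3 ∷ 2 ∷  4 ∷  6 ∷ []) ∷
  (1 ∷  5 ∷ 2 ∷ 13 ∷ 14 ∷ []) ∷
  (1 ∷  3 ∷ 2 ∷  4 ∷ 12 ∷ []) ∷
  (1 ∷  7 ∷ 2 ∷  6 ∷  8 ∷ []) ∷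
  (1 ∷  3 ∷ 2 ∷  4 ∷  5 ∷ []) ∷
  (1 ∷  9 ∷ 2 ∷ 10 ∷ 11 ∷ []) ∷
  (1 ∷  3 ∷ 2 ∷  4 ∷  6 ∷ []) ∷
  (1 ∷  5 ∷ 2 ∷  7 ∷  8 ∷ []) ∷
  (1 ∷  3 ∷ 2 ∷  4 ∷ 12 ∷ []) ∷
  (1 ∷ 13 ∷ 2 ∷  6 ∷ 14 ∷ []) ∷
  []

columnOf : ℕ → Vec (Fin 5) 5
columnOf 3 = # 0 ∷ # 2 ∷ # 1 ∷ # 3 ∷ # 4 ∷ []
columnOf 4 = # 0 ∷ # 2 ∷ # 3 ∷ # 1 ∷ # 4 ∷ []
columnOf 5 = # 0 ∷ # 2 ∷ # 3 ∷ # 4 ∷ # 1 ∷ []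
columnOf _ = # 0 ∷ # 1 ∷ # 2 ∷ # 3 ∷ # 4 ∷ []

tablePattern : ℕ → Pattern 24 5
tablePattern ℓ r j = lookup (lookup colourTable r) (lookup (columnOf ℓ) j)

tablePattern-valid : ∀ ℓ → 2 ≤ ℓ → ℓ ≤ 5 → IsPackingPattern ℓ 14 7 (tablePattern ℓ)
tablePattern-valid 1 (s≤s ()) _
tablePattern-valid 2 _ _ = toWitness {a? = isPackingPattern? 2 14 7 (tablePattern 2)} tt
tablePattern-valid 3 _ _ = toWitness {a? = isPackingPattern? 3 14 7 (tablePattern 3)} tt
tablePattern-valid 4 _ _ = toWitness {a? = isPackingPattern? 4 14 7 (tablePattern 4)} tt
tablePattern-valid 5 _ _ = toWitness {a? = isPackingPattern? 5 14 7 (tablePattern 5)} tt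
tablePattern-valid (suc (suc (suc (suc (suc (suc _)))))) _ (s≤s (s≤s (s≤s (s≤s (s≤s ())))))

theorem16 : (t ℓ : ℕ) → 1 ≤ t → 2 ≤ ℓ → ℓ ≤ 5 →
    χp≤ (PathAlignedK 5 ℓ t) 14
theorem16 t ℓ _ 2≤ℓ ℓ≤5 = periodic-packing 2≤ℓ ≤-refl (tablePattern-valid ℓ 2≤ℓ ℓ≤5) t
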